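{- Let $k$ and $n$ be positive integers, and let $M$ and $N$ be $n$-element sparse paving matroids each having exactly $k$ circuit-hyperplanes. Then $M$ and $N$ are isomorphic if and only if $\mathcal{R}_{k}^{n}(M)\cap\mathcal{R}_{k}^{n}(N)\neq\emptyset$.
   Context: A matroid is sparse paving if every non-spanning circuit is a hyperplane. For a set $E$ and a sequence $\mathcal{C}=(C_{1},\ldots,C_{k})$ of subsets of $E$, for each $I\subseteq\{1,\ldots,k\}$ let $\mathcal{C}(I)=\left(\bigcap_{i\in I}C_{i}\right)\cap\left(\bigcap_{i\in\{1,\ldots,k\}-I}(E-C_{i})\right)$, and let $\psi_{\mathcal{C}}$ be the function from the power set of $\{1,\ldots,k\}$ to the non-negative integers sending $I$ to $|\mathcal{C}(I)|$. For an $n$-element sparse paving matroid $M$ with exactly $k$ circuit-hyperplanes and ground set $E$, $\mathcal{R}_{k}^{n}(M)$ is the set of functions $\psi_{\mathcal{C}}$ where $\mathcal{C}$ ranges over all orderings $(C_{1},\ldots,C_{k})$ of the circuit-hyperplanes of $M$. -}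

module Defs where

open import Data.Nat using (ℕ; _<_)
open import Data.Bool using (Bool; true; false; T; not; _∧_)
open import Data.Fin using (Fin; zero; suc)
open import Data.Fin.Subset using (Subset; ⊥; _∈_; _∉_; _⊆_; _⊂_; _∪_; ⁅_⁆; ∣_∣)
open import Data.Fin.Permutation using (Permutation′; _⟨$⟩ˡ_)
open import Data.Vec using (lookup; tabulate)
open import Data.Product using (Σ; ∃; _×_; _,_)
open import Relation.Nullary using (¬_)
open import Relation.Binary.PropositionalEquality using (_≡_)
open import Function.Definitions using (Injective)

record Matroid (n : ℕ) : Set where
  field
    indep       : Subset n → Bool
    indep-empty : T (indep ⊥)
    indep-hered : ∀ {X Y} → X ⊆ Y → T (indep Y) → T (indep X)
    indep-aug   : ∀ {X Y} → T (indep X) → T (indep Y) → ∣ X ∣ < ∣ Y ∣ →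
                  ∃ λ e → e ∈ Y × e ∉ X × T (indep (X ∪ ⁅ e ⁆))

module _ {n : ℕ} (M : Matroid n) where
  open Matroid M

  Indep : Subset n → Set
  Indep X = T (indep X)

  Basis : Subset n → Set
  Basis B = Indep B × (∀ X → B ⊂ X → ¬ Indep X)

  Spanning : Subset n → Set
  Spanning X = ∃ λ B → B ⊆ X × Basis B

  Circuit : Subset n → Set
  Circuit C = ¬ Indep C × (∀ X → X ⊂ C → Indep X)

  Hyperplane : Subset n → Set
  Hyperplane H = ¬ Spanning H × (∀ X → H ⊂ X → Spanning X)

  CircuitHyperplane : Subset n → Set
  CircuitHyperplane X = Circuit X × Hyperplane X

  SparsePaving : Set
  SparsePaving = ∀ C → Circuit C → ¬ Spanning C → Hyperplane C

  IsCHOrdering : (k : ℕ) → (Fin k → Subset n) → Set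
  IsCHOrdering k C = Injective _≡_ _≡_ C
                   × (∀ i → CircuitHyperplane (C i))
                   × (∀ X → CircuitHyperplane X → ∃ λ i → C i ≡ X)

  HasExactlyCH : ℕ → Set
  HasExactlyCH k = ∃ λ (C : Fin k → Subset n) → IsCHOrdering k C

allᶠ : ∀ {k} → (Fin k → Bool) → Bool
allᶠ {ℕ.zero}  f = true
allᶠ {ℕ.suc k} f = f zero ∧ allᶠ (λ i → f (suc i))

_⇔ᵇ_ : Bool → Bool → Bool
true  ⇔ᵇ b = b
false ⇔ᵇ b = not b

-- 𝒞(I) = (⋂_{i∈I} C_i) ∩ (⋂_{i∉I} (E - C_i))
atom : ∀ {n k} → (Fin k → Subset n) → Subset k → Subset n
atom C I = tabulate λ e → allᶠ λ i → lookup (C i) e ⇔ᵇ lookup I i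

ψ : ∀ {n k} → (Fin k → Subset n) → Subset k → ℕ
ψ C I = ∣ atom C I ∣

-- φ ∈ ℛ_k^n(M)  (functions on the power set compared pointwise)
InR : ∀ {n} → Matroid n → (k : ℕ) → (Subset k → ℕ) → Set
InR M k φ = ∃ λ C → IsCHOrdering M k C × (∀ I → φ I ≡ ψ C I)

image : ∀ {n} → Permutation′ n → Subset n → Subset n
image π X = tabulate λ j → lookup X (π ⟨$⟩ˡ j)

Isomorphic : ∀ {n} → Matroid n → Matroid n → Set
Isomorphic M N = ∃ λ (π : Permutation′ _) →
  ∀ X → Matroid.indep M X ≡ Matroid.indep N (image π X)

-- In a sparse paving matroid with a circuit-hyperplane H, a set X is independent
-- exactly when |X| ≤ |H| and X is not itself a circuit-hyperplane: a dependent such X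
-- contains a circuit Z, which cannot span (a basis inside Z has at least |H| ≥ |X|
-- elements, so it would be X), so Z is a circuit-hyperplane; as circuit-hyperplanes
-- have the size of a basis, Z = X. So a permutation of the ground set carrying the
-- circuit-hyperplanes of M onto those of N is an isomorphism.
--
-- ψ_𝒞(I) counts the elements e whose membership pattern {i | e ∈ C_i} equals I. If
-- ψ_𝒞 = ψ_𝒟, the membership-pattern maps of 𝒞 and 𝒟 have fibres of equal sizes, so
-- they differ by a permutation of the ground set, and that permutation carries each
-- C_i to D_i. Conversely an isomorphism carries an ordering of the circuit-hyperplanes
-- of M to one of N, and permutes each atom 𝒞(I), so it preserves ψ.

module Submission where

open import Defs
open import Data.Bool using (Bool; true; false; T; T?; _∧_)
open import Data.Bool.Properties using (T-≡; T-∧)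
open import Data.Empty using (⊥-elim)
open import Data.Fin using (Fin; zero; suc; punchIn)
open import Data.Fin.Properties using (any?)
open import Data.Fin.Permutation using (Permutation′; id; insert; insert-punchIn; _⟨$⟩ʳ_; _⟨$⟩ˡ_; flip; inverseˡ)
open import Data.Fin.Subset using (Subset; _∈_; _∉_; _⊆_; _⊂_; _∪_; _-_; ∣_∣; Nonempty; ⁅_⁆)
open import Data.Fin.Subset.Properties
  using ( _∈?_; _⊂?_; anySubset?; nonempty?; Empty-unique; ∣p∣≤n; ∣⊥∣≡0; ∣⁅x⁆∣≡1; x∈⁅x⁆; x∈⁅y⁆⇒x≡y
        ; ⊆-refl; ⊆-trans; ⊆-antisym; x∈p⇒p-x⊂p; p⊂q⇒p⊆q; p⊆q⇒∣p∣≤∣q∣; p⊂q⇒∣p∣<∣q∣; p⊆p∪q; q⊆p∪q; x∈p∪q⁻; p─⊥≡p; p─q⊆p )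
open import Data.Nat using (ℕ; zero; suc; _+_; _≤_; _<_; s≤s)
open import Data.Nat.Properties
  using ( +-0-commutativeMonoid; +-cancelˡ-≡; +-suc; +-monoʳ-≤; ≤-reflexive; ≤-trans; ≤-<-trans; ≤-pred
        ; ≤⇒≯; ≮⇒≥; ≰⇒>; m≤m+n; m≤n⇒m≤1+n; module ≤-Reasoning )
open import Data.Sum using (inj₁; inj₂; [_,_]′)
open import Data.Product using (∃; _×_; _,_; proj₁; proj₂)
open import Data.Vec using (_∷_; there; lookup; tabulate)
open import Data.Vec.Properties using (lookup∘tabulate; tabulate∘lookup; tabulate-cong; []=⇒lookup; lookup⇒[]=)
open import Data.Vec.Relation.Binary.Pointwise.Extensional using (ext; Pointwise-≡⇒≡)
open import Function using (_∘_)
open import Function.Properties.Equivalence using () renaming (trans to ⇔-trans; sym to ⇔-sym)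
open import Function.Bundles using (_⇔_; mk⇔; Equivalence)
open import Relation.Binary.PropositionalEquality using (_≡_; refl; sym; trans; cong; cong₂; subst; module ≡-Reasoning)
open import Relation.Nullary using (¬_; yes; no; ¬?; contradiction)
open import Relation.Nullary.Decidable using (_×-dec_; decidable-stable)

open import Algebra.Properties.CommutativeMonoid.Sum +-0-commutativeMonoid using (sum; sum-remove; sum-permute)
open Equivalence using (to; from)

-- Sizes of subsets of Fin n

indicator : Bool → ℕ
indicator true  = 1
indicator false = 0

∣b∷p∣ : ∀ {n} b (p : Subset n) → ∣ b ∷ p ∣ ≡ indicator b + ∣ p ∣
∣b∷p∣ true  p = refl
∣b∷p∣ false p = refl

∣tabulate∣≡sum : ∀ {n} (h : Fin n → Bool) → ∣ tabulate h ∣ ≡ sum (indicator ∘ h)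
∣tabulate∣≡sum {zero}  h = refl
∣tabulate∣≡sum {suc n} h =
  trans (∣b∷p∣ (h zero) (tabulate (h ∘ suc))) (cong (indicator (h zero) +_) (∣tabulate∣≡sum (h ∘ suc)))

∣tabulate∣-punchIn : ∀ {n} (j : Fin (suc n)) (h : Fin (suc n) → Bool) →
                     ∣ tabulate h ∣ ≡ indicator (h j) + ∣ tabulate (h ∘ punchIn j) ∣
∣tabulate∣-punchIn j h = begin
  ∣ tabulate h ∣                                    ≡⟨ ∣tabulate∣≡sum h ⟩
  sum (indicator ∘ h)                               ≡⟨ sum-remove (indicator ∘ h) ⟩
  indicator (h j) + sum (indicator ∘ h ∘ punchIn j) ≡⟨ cong (indicator (h j) +_) (∣tabulate∣≡sum (h ∘ punchIn j)) ⟨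
  indicator (h j) + ∣ tabulate (h ∘ punchIn j) ∣    ∎
  where open ≡-Reasoning

∣tabulate∘permute∣ : ∀ {n} (π : Permutation′ n) (h : Fin n → Bool) →
                     ∣ tabulate (h ∘ (π ⟨$⟩ʳ_)) ∣ ≡ ∣ tabulate h ∣
∣tabulate∘permute∣ π h = begin
  ∣ tabulate (h ∘ (π ⟨$⟩ʳ_)) ∣    ≡⟨ ∣tabulate∣≡sum (h ∘ (π ⟨$⟩ʳ_)) ⟩
  sum (indicator ∘ h ∘ (π ⟨$⟩ʳ_)) ≡⟨ sum-permute (indicator ∘ h) π ⟨
  sum (indicator ∘ h)            ≡⟨ ∣tabulate∣≡sum h ⟨
  ∣ tabulate h ∣                 ∎
  where open ≡-Reasoning

∈⇔T-lookup : ∀ {n} {x} {p : Subset n} → x ∈ p ⇔ T (lookup p x)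
∈⇔T-lookup {x = x} {p} = mk⇔ (from T-≡ ∘ []=⇒lookup) (lookup⇒[]= x p ∘ to T-≡)

∈-tabulate : ∀ {n} {x} (h : Fin n → Bool) → x ∈ tabulate h ⇔ T (h x)
∈-tabulate {x = x} h = subst (λ b → x ∈ tabulate h ⇔ T b) (lookup∘tabulate h x) ∈⇔T-lookup

0<∣p∣⇒Nonempty : ∀ {n} (p : Subset n) → 0 < ∣ p ∣ → Nonempty p
0<∣p∣⇒Nonempty {n} p 0<∣p∣ with nonempty? p
... | yes p-nonempty = p-nonempty
... | no  p-empty with () ← subst (0 <_) (trans (cong ∣_∣ (Empty-unique p-empty)) (∣⊥∣≡0 n)) 0<∣p∣

x∈p⇒0<∣p∣ : ∀ {n} {x} {p : Subset n} → x ∈ p → 0 < ∣ p ∣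
x∈p⇒0<∣p∣ {x = x} x∈p =
  subst (_≤ _) (∣⁅x⁆∣≡1 x) (p⊆q⇒∣p∣≤∣q∣ λ y∈⁅x⁆ → subst (_∈ _) (sym (x∈⁅y⁆⇒x≡y x y∈⁅x⁆)) x∈p)

p⊆q∧∣q∣≤∣p∣⇒q⊆p : ∀ {n} {p q : Subset n} → p ⊆ q → ∣ q ∣ ≤ ∣ p ∣ → q ⊆ p
p⊆q∧∣q∣≤∣p∣⇒q⊆p {p = p} p⊆q ∣q∣≤∣p∣ {x} x∈q with x ∈? p
... | yes x∈p = x∈p
... | no  x∉p = contradiction (p⊂q⇒∣p∣<∣q∣ (p⊆q , x , x∈q , x∉p)) (≤⇒≯ ∣q∣≤∣p∣)

∣p∣≤1+∣p-x∣ : ∀ {n} (p : Subset n) x → ∣ p ∣ ≤ suc ∣ p - x ∣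
∣p∣≤1+∣p-x∣ (true  ∷ p) zero    = s≤s (≤-reflexive (cong ∣_∣ (sym (p─⊥≡p p))))
∣p∣≤1+∣p-x∣ (false ∷ p) zero    = m≤n⇒m≤1+n (≤-reflexive (cong ∣_∣ (sym (p─⊥≡p p))))
∣p∣≤1+∣p-x∣ (true  ∷ p) (suc x) = s≤s (∣p∣≤1+∣p-x∣ p x)
∣p∣≤1+∣p-x∣ (false ∷ p) (suc x) = ∣p∣≤1+∣p-x∣ p x

x∉p-x : ∀ {n} (p : Subset n) x → x ∉ p - x
x∉p-x (s ∷ p) zero    ()
x∉p-x (s ∷ p) (suc x) (there x∈p-x) = x∉p-x p x x∈p-x

p⊂p∪⁅x⁆ : ∀ {n} {p : Subset n} {x} → x ∉ p → p ⊂ p ∪ ⁅ x ⁆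
p⊂p∪⁅x⁆ {p = p} {x} x∉p = p⊆p∪q ⁅ x ⁆ , x , q⊆p∪q p ⁅ x ⁆ (x∈⁅x⁆ x) , x∉p

p∪⁅x⁆⊆q : ∀ {n} {p q : Subset n} {x} → p ⊆ q → x ∈ q → p ∪ ⁅ x ⁆ ⊆ q
p∪⁅x⁆⊆q {p = p} {q} {x} p⊆q x∈q =
  [ p⊆q , (λ y∈⁅x⁆ → subst (_∈ q) (sym (x∈⁅y⁆⇒x≡y x y∈⁅x⁆)) x∈q) ]′ ∘ x∈p∪q⁻ p ⁅ x ⁆

p⊆q∪⁅x⁆⇒p-x⊆q : ∀ {n} {p q : Subset n} {x} → p ⊆ q ∪ ⁅ x ⁆ → p - x ⊆ q
p⊆q∪⁅x⁆⇒p-x⊆q {p = p} {q} {x} p⊆q∪x y∈p-x with x∈p∪q⁻ q ⁅ x ⁆ (p⊆q∪x (p─q⊆p p ⁅ x ⁆ y∈p-x))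
... | inj₁ y∈q   = y∈q
... | inj₂ y∈⁅x⁆ = contradiction (subst (_∈ p - x) (x∈⁅y⁆⇒x≡y x y∈⁅x⁆) y∈p-x) (x∉p-x p x)

-- Bases, circuits and hyperplanes

module _ {n} (M : Matroid n) where
  open Matroid M

  extend-to-basis : ∀ {X} → Indep M X → ∃ λ B → X ⊆ B × Basis M B
  extend-to-basis {X} = go n (m≤m+n n ∣ X ∣)
    where
    go : ∀ m {X} → n ≤ m + ∣ X ∣ → Indep M X → ∃ λ B → X ⊆ B × Basis M B
    go m {X} bound indX with any? (λ e → ¬? (e ∈? X) ×-dec T? (indep (X ∪ ⁅ e ⁆)))
    ... | no maximal = X , ⊆-refl , indX ,
          λ { Y (X⊆Y , y , y∈Y , y∉X) indY → maximal (y , y∉X , indep-hered (p∪⁅x⁆⊆q X⊆Y y∈Y) indY) }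
    go zero    {X} bound indX | yes (e , e∉X , _) =
      contradiction (≤-<-trans bound (p⊂q⇒∣p∣<∣q∣ (p⊂p∪⁅x⁆ e∉X))) (≤⇒≯ (∣p∣≤n (X ∪ ⁅ e ⁆)))
    go (suc m) {X} bound indX | yes (e , e∉X , indX∪e)
      with B , X∪e⊆B , basis ← go m (≤-trans bound (≤-trans (≤-reflexive (sym (+-suc m ∣ X ∣)))
                                      (+-monoʳ-≤ m (p⊂q⇒∣p∣<∣q∣ (p⊂p∪⁅x⁆ e∉X))))) indX∪e
      = B , X∪e⊆B ∘ p⊆p∪q ⁅ e ⁆ , basis

  ∃basis : ∃ (Basis M)
  ∃basis with B , _ , basis ← extend-to-basis indep-empty = B , basis

  ∃circuit⊆ : ∀ {X} → ¬ Indep M X → ∃ λ Z → Z ⊆ X × Circuit M Z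
  ∃circuit⊆ {X} = go n (∣p∣≤n X)
    where
    go : ∀ m {X} → ∣ X ∣ ≤ m → ¬ Indep M X → ∃ λ Z → Z ⊆ X × Circuit M Z
    go m {X} bound dep with anySubset? (λ Y → Y ⊂? X ×-dec ¬? (T? (indep Y)))
    ... | no minimal = X , ⊆-refl , dep ,
          λ Y Y⊂X → decidable-stable (T? (indep Y)) λ depY → minimal (Y , Y⊂X , depY)
    go zero    bound dep | yes (Y , Y⊂X , _) = contradiction (≤-trans (p⊂q⇒∣p∣<∣q∣ Y⊂X) bound) λ ()
    go (suc m) bound dep | yes (Y , Y⊂X , depY)
      with Z , Z⊆Y , circuit ← go m (≤-pred (≤-trans (p⊂q⇒∣p∣<∣q∣ Y⊂X) bound)) depY
      = Z , ⊆-trans Z⊆Y (p⊂q⇒p⊆q Y⊂X) , circuit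

  ∣indep∣≤∣basis∣ : ∀ {B Y} → Basis M B → Indep M Y → ∣ Y ∣ ≤ ∣ B ∣
  ∣indep∣≤∣basis∣ {B} (indB , maximal) indY = ≮⇒≥ λ ∣B∣<∣Y∣ →
    let e , _ , e∉B , indB∪e = indep-aug indB indY ∣B∣<∣Y∣ in maximal (B ∪ ⁅ e ⁆) (p⊂p∪⁅x⁆ e∉B) indB∪e

  nonSpanning⇒∃∉ : ∀ {X} → ¬ Spanning M X → ∃ λ e → e ∉ X
  nonSpanning⇒∃∉ {X} nonSpanning with any? (λ e → ¬? (e ∈? X))
  ... | yes e∉X = e∉X
  ... | no  X-full with B , basis ← ∃basis =
    contradiction (B , (λ {x} _ → decidable-stable (x ∈? X) λ x∉X → X-full (x , x∉X)) , basis) nonSpanning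

  ∣nonSpanningCircuit∣≤∣basis∣ : ∀ {C B} → Circuit M C → ¬ Spanning M C → Basis M B → ∣ C ∣ ≤ ∣ B ∣
  ∣nonSpanningCircuit∣≤∣basis∣ {C} (dep , minimal) nonSpanning basis with nonempty? C
  ... | no  C-empty = contradiction (subst (Indep M) (sym (Empty-unique C-empty)) indep-empty) dep
  ... | yes (x , x∈C) with B′ , C-x⊆B′ , basis′ ← extend-to-basis (minimal (C - x) (x∈p⇒p-x⊂p x∈C))
    = ≤-trans ∣C∣≤∣B′∣ (∣indep∣≤∣basis∣ basis (proj₁ basis′))
    where
    ∣C∣≤∣B′∣ : ∣ C ∣ ≤ ∣ B′ ∣
    ∣C∣≤∣B′∣ = ≮⇒≥ λ ∣B′∣<∣C∣ →
      let B′⊆C-x = p⊆q∧∣q∣≤∣p∣⇒q⊆p C-x⊆B′ (≤-pred (≤-trans ∣B′∣<∣C∣ (∣p∣≤1+∣p-x∣ C x)))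
      in nonSpanning (B′ , ⊆-trans B′⊆C-x (p─q⊆p C ⁅ x ⁆) , basis′)

  ∣indep∣≤∣dependentHyperplane∣ : ∀ {H Y} → Hyperplane M H → ¬ Indep M H → Indep M Y → ∣ Y ∣ ≤ ∣ H ∣
  ∣indep∣≤∣dependentHyperplane∣ {H} (nonSpanning , maximal) dep indY
    with e , e∉H ← nonSpanning⇒∃∉ nonSpanning
    with B , B⊆H∪e , basis ← maximal (H ∪ ⁅ e ⁆) (p⊂p∪⁅x⁆ e∉H)
    = ≤-trans (∣indep∣≤∣basis∣ basis indY) (≤-trans (∣p∣≤1+∣p-x∣ B e) ∣B-e∣<∣H∣)
    where
    ∣B-e∣<∣H∣ : ∣ B - e ∣ < ∣ H ∣
    ∣B-e∣<∣H∣ = ≰⇒> λ ∣H∣≤∣B-e∣ →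
      let H⊆B-e = p⊆q∧∣q∣≤∣p∣⇒q⊆p (p⊆q∪⁅x⁆⇒p-x⊆q B⊆H∪e) ∣H∣≤∣B-e∣
      in dep (indep-hered (⊆-trans H⊆B-e (p─q⊆p B ⁅ e ⁆)) (proj₁ basis))

  sparsePaving-indep : SparsePaving M → ∀ {H X} → CircuitHyperplane M H →
                       ∣ X ∣ ≤ ∣ H ∣ → ¬ CircuitHyperplane M X → Indep M X
  sparsePaving-indep sparse {H} {X} (circuitH , nonSpanningH , _) ∣X∣≤∣H∣ ¬circuitHyperplane =
    decidable-stable (T? (indep X)) ¬dependent
    where
    ∣X∣≤∣basis∣ : ∀ {B} → Basis M B → ∣ X ∣ ≤ ∣ B ∣
    ∣X∣≤∣basis∣ basis = ≤-trans ∣X∣≤∣H∣ (∣nonSpanningCircuit∣≤∣basis∣ circuitH nonSpanningH basis)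

    ¬dependent : ¬ ¬ Indep M X
    ¬dependent dep with Z , Z⊆X , circuitZ ← ∃circuit⊆ dep =
      ¬circuitHyperplane (subst (CircuitHyperplane M) (⊆-antisym Z⊆X X⊆Z) (circuitZ , hyperplaneZ))
      where
      nonSpanningZ : ¬ Spanning M Z
      nonSpanningZ (B , B⊆Z , basis) =
        dep (indep-hered (p⊆q∧∣q∣≤∣p∣⇒q⊆p (⊆-trans B⊆Z Z⊆X) (∣X∣≤∣basis∣ basis)) (proj₁ basis))

      hyperplaneZ : Hyperplane M Z
      hyperplaneZ = sparse Z circuitZ nonSpanningZ

      X⊆Z : X ⊆ Z
      X⊆Z with B , basis ← ∃basis =
        p⊆q∧∣q∣≤∣p∣⇒q⊆p Z⊆X (≤-trans (∣X∣≤∣basis∣ basis)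
          (∣indep∣≤∣dependentHyperplane∣ hyperplaneZ (proj₁ circuitZ) (proj₁ basis)))

-- Images under a permutation of the ground set

module _ {n} (π : Permutation′ n) where

  ∈-image : ∀ {x X} → x ∈ image π X ⇔ π ⟨$⟩ˡ x ∈ X
  ∈-image {X = X} = ⇔-trans (∈-tabulate (lookup X ∘ (π ⟨$⟩ˡ_))) (⇔-sym ∈⇔T-lookup)

  image-⊆ : ∀ {X Y} → X ⊆ Y → image π X ⊆ image π Y
  image-⊆ X⊆Y = from ∈-image ∘ X⊆Y ∘ to ∈-image

  image-⊂ : ∀ {X Y} → X ⊂ Y → image π X ⊂ image π Y
  image-⊂ {X} {Y} (X⊆Y , x , x∈Y , x∉X) =
    image-⊆ X⊆Y , π ⟨$⟩ʳ x ,
    from ∈-image (subst (_∈ Y) (sym (inverseˡ π)) x∈Y) ,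
    x∉X ∘ subst (_∈ X) (inverseˡ π) ∘ to ∈-image

  image-flip-image : ∀ X → image (flip π) (image π X) ≡ X
  image-flip-image X = trans (tabulate-cong λ x → trans (lookup∘tabulate _ (π ⟨$⟩ʳ x)) (cong (lookup X) (inverseˡ π)))
                             (tabulate∘lookup X)

  image-injective : ∀ {X Y} → image π X ≡ image π Y → X ≡ Y
  image-injective {X} {Y} eq = trans (sym (image-flip-image X)) (trans (cong (image (flip π)) eq) (image-flip-image Y))

  ∣image∣ : ∀ X → ∣ image π X ∣ ≡ ∣ X ∣
  ∣image∣ X = trans (∣tabulate∘permute∣ (flip π) (lookup X)) (cong ∣_∣ (tabulate∘lookup X))

image-image-flip : ∀ {n} (π : Permutation′ n) X → image π (image (flip π) X) ≡ X
image-image-flip π = image-flip-image (flip π)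

image⊂⇒⊂image-flip : ∀ {n} (π : Permutation′ n) {X Y} → image π X ⊂ Y → X ⊂ image (flip π) Y
image⊂⇒⊂image-flip π {X} πX⊂Y = subst (_⊂ _) (image-flip-image π X) (image-⊂ (flip π) πX⊂Y)

⊂image⇒image-flip⊂ : ∀ {n} (π : Permutation′ n) {X Y} → Y ⊂ image π X → image (flip π) Y ⊂ X
⊂image⇒image-flip⊂ π {X} Y⊂πX = subst (_ ⊂_) (image-flip-image π X) (image-⊂ (flip π) Y⊂πX)

record IsIsomorphism {n} (M N : Matroid n) (π : Permutation′ n) : Set where
  constructor mkIsIsomorphism
  field
    indep-image : ∀ X → Matroid.indep M X ≡ Matroid.indep N (image π X)

open IsIsomorphism

module _ {n} {M N : Matroid n} {π : Permutation′ n} (iso : IsIsomorphism M N π) where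

  isIsomorphism-flip : IsIsomorphism N M (flip π)
  isIsomorphism-flip = mkIsIsomorphism λ Y →
    sym (trans (indep-image iso (image (flip π) Y)) (cong (Matroid.indep N) (image-image-flip π Y)))

  image-indep : ∀ {X} → Indep M X → Indep N (image π X)
  image-indep {X} = subst T (indep-image iso X)

  image-dependent : ∀ {X} → ¬ Indep M X → ¬ Indep N (image π X)
  image-dependent {X} dep = dep ∘ subst T (sym (indep-image iso X))

module _ {n} {M N : Matroid n} {π : Permutation′ n} (iso : IsIsomorphism M N π) where

  image-basis : ∀ {B} → Basis M B → Basis N (image π B)
  image-basis (indB , maximal) =
    image-indep iso indB ,
    λ Y πB⊂Y indY → maximal _ (image⊂⇒⊂image-flip π πB⊂Y) (image-indep (isIsomorphism-flip iso) indY)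

  image-spanning : ∀ {X} → Spanning M X → Spanning N (image π X)
  image-spanning (B , B⊆X , basis) = image π B , image-⊆ π B⊆X , image-basis basis

module _ {n} {M N : Matroid n} {π : Permutation′ n} (iso : IsIsomorphism M N π) where

  image-circuit : ∀ {C} → Circuit M C → Circuit N (image π C)
  image-circuit (dep , minimal) =
    image-dependent iso dep ,
    λ Y Y⊂πC → subst (Indep N) (image-image-flip π Y) (image-indep iso
                 (minimal _ (⊂image⇒image-flip⊂ π Y⊂πC)))

  image-hyperplane : ∀ {H} → Hyperplane M H → Hyperplane N (image π H)
  image-hyperplane {H} (nonSpanning , maximal) =
    nonSpanning ∘ subst (Spanning M) (image-flip-image π H) ∘ image-spanning (isIsomorphism-flip iso) ,
    λ Y πH⊂Y → subst (Spanning N) (image-image-flip π Y)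
                 (image-spanning iso (maximal _ (image⊂⇒⊂image-flip π πH⊂Y)))

  image-circuitHyperplane : ∀ {X} → CircuitHyperplane M X → CircuitHyperplane N (image π X)
  image-circuitHyperplane (circuit , hyperplane) = image-circuit circuit , image-hyperplane hyperplane

-- Membership patterns and the atoms 𝒞(I)

module _ {A : Set} (_==_ : A → A → Bool) where

  fibre : ∀ {n} → (Fin n → A) → A → Subset n
  fibre f a = tabulate λ e → f e == a

  equal-fibres⇒permutation : (∀ {a b} → T (a == b) ⇔ a ≡ b) →
    ∀ {n} (f g : Fin n → A) → (∀ a → ∣ fibre f a ∣ ≡ ∣ fibre g a ∣) →
    ∃ λ (σ : Permutation′ n) → ∀ e → g (σ ⟨$⟩ʳ e) ≡ f e
  equal-fibres⇒permutation T-==⇔≡ {zero}  f g _ = id , λ ()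
  equal-fibres⇒permutation T-==⇔≡ {suc n} f g same =
    insert zero j τ , λ { zero → gj≡f₀ ; (suc e) → trans (cong g (insert-punchIn zero j τ e)) (τ-matches e) }
    where
    0∈fibre-f : zero ∈ fibre f (f zero)
    0∈fibre-f = from (∈-tabulate (λ e → f e == f zero)) (from T-==⇔≡ refl)

    fibre-g-nonempty : Nonempty (fibre g (f zero))
    fibre-g-nonempty = 0<∣p∣⇒Nonempty _ (subst (0 <_) (same (f zero)) (x∈p⇒0<∣p∣ 0∈fibre-f))

    j : Fin (suc n)
    j = proj₁ fibre-g-nonempty

    gj≡f₀ : g j ≡ f zero
    gj≡f₀ = to T-==⇔≡ (to (∈-tabulate (λ e → g e == f zero)) (proj₂ fibre-g-nonempty))

    same-rest : ∀ a → ∣ fibre (f ∘ suc) a ∣ ≡ ∣ fibre (g ∘ punchIn j) a ∣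
    same-rest a = +-cancelˡ-≡ (indicator (f zero == a)) _ _ (begin
      indicator (f zero == a) + ∣ fibre (f ∘ suc) a ∣      ≡⟨ ∣tabulate∣-punchIn zero (λ e → f e == a) ⟨
      ∣ fibre f a ∣                                        ≡⟨ same a ⟩
      ∣ fibre g a ∣                                        ≡⟨ ∣tabulate∣-punchIn j (λ e → g e == a) ⟩
      indicator (g j == a) + ∣ fibre (g ∘ punchIn j) a ∣   ≡⟨ cong (λ x → indicator (x == a) + ∣ fibre (g ∘ punchIn j) a ∣) gj≡f₀ ⟩
      indicator (f zero == a) + ∣ fibre (g ∘ punchIn j) a ∣ ∎)
      where open ≡-Reasoning

    rest : ∃ λ (τ : Permutation′ n) → ∀ e → g (punchIn j (τ ⟨$⟩ʳ e)) ≡ f (suc e)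
    rest = equal-fibres⇒permutation T-==⇔≡ (f ∘ suc) (g ∘ punchIn j) same-rest

    τ : Permutation′ n
    τ = proj₁ rest

    τ-matches : ∀ e → g (punchIn j (τ ⟨$⟩ʳ e)) ≡ f (suc e)
    τ-matches = proj₂ rest

T-allᶠ : ∀ {k} (f : Fin k → Bool) → T (allᶠ f) ⇔ (∀ i → T (f i))
T-allᶠ {zero}  f = mk⇔ (λ _ ()) _
T-allᶠ {suc k} f = mk⇔
  (λ t → λ { zero → proj₁ (to T-∧ t) ; (suc i) → to (T-allᶠ (f ∘ suc)) (proj₂ (to T-∧ t)) i })
  (λ all → from T-∧ (all zero , from (T-allᶠ (f ∘ suc)) (all ∘ suc)))

allᶠ-cong : ∀ {k} {f g : Fin k → Bool} → (∀ i → f i ≡ g i) → allᶠ f ≡ allᶠ g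
allᶠ-cong {zero}  f≗g = refl
allᶠ-cong {suc k} f≗g = cong₂ _∧_ (f≗g zero) (allᶠ-cong (f≗g ∘ suc))

T-⇔ᵇ : ∀ {a b} → T (a ⇔ᵇ b) ⇔ a ≡ b
T-⇔ᵇ {true}  {true}  = mk⇔ (λ _ → refl) _
T-⇔ᵇ {true}  {false} = mk⇔ (λ ()) (λ ())
T-⇔ᵇ {false} {true}  = mk⇔ (λ ()) (λ ())
T-⇔ᵇ {false} {false} = mk⇔ (λ _ → refl) _

_==_ : ∀ {k} → Subset k → Subset k → Bool
u == v = allᶠ λ i → lookup u i ⇔ᵇ lookup v i

T-== : ∀ {k} {u v : Subset k} → T (u == v) ⇔ u ≡ v
T-== {u = u} {v} = mk⇔
  (λ t → Pointwise-≡⇒≡ (ext λ i → to T-⇔ᵇ (to (T-allᶠ (λ i → lookup u i ⇔ᵇ lookup v i)) t i)))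
  (λ { refl → from (T-allᶠ (λ i → lookup u i ⇔ᵇ lookup u i)) λ i → from (T-⇔ᵇ {lookup u i}) refl })

membership : ∀ {n k} → (Fin k → Subset n) → Fin n → Subset k
membership C e = tabulate λ i → lookup (C i) e

ψ≡∣fibre∣ : ∀ {n k} (C : Fin k → Subset n) I → ψ C I ≡ ∣ fibre _==_ (membership C) I ∣
ψ≡∣fibre∣ C I = cong ∣_∣ {atom C I} (tabulate-cong λ e → allᶠ-cong λ i → cong (_⇔ᵇ lookup I i) (sym (lookup∘tabulate _ i)))

atom-image : ∀ {n k} (π : Permutation′ n) (C : Fin k → Subset n) I → atom (image π ∘ C) I ≡ image π (atom C I)
atom-image π C I = tabulate-cong λ e →
  trans (allᶠ-cong λ i → cong (_⇔ᵇ lookup I i) (lookup∘tabulate _ e)) (sym (lookup∘tabulate _ (π ⟨$⟩ˡ e)))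

ψ-image : ∀ {n k} (π : Permutation′ n) (C : Fin k → Subset n) I → ψ (image π ∘ C) I ≡ ψ C I
ψ-image π C I = trans (cong ∣_∣ (atom-image π C I)) (∣image∣ π (atom C I))

membership-matching⇒image : ∀ {n k} (C D : Fin k → Subset n) (σ : Permutation′ n) →
  (∀ e → membership C (σ ⟨$⟩ʳ e) ≡ membership D e) → ∀ i → image (flip σ) (C i) ≡ D i
membership-matching⇒image C D σ σ-matches i = trans (tabulate-cong lookup-C) (tabulate∘lookup (D i))
  where
  lookup-C : ∀ e → lookup (C i) (σ ⟨$⟩ʳ e) ≡ lookup (D i) e
  lookup-C e = begin
    lookup (C i) (σ ⟨$⟩ʳ e)                ≡⟨ lookup∘tabulate _ i ⟨
    lookup (membership C (σ ⟨$⟩ʳ e)) i     ≡⟨ cong (λ u → lookup u i) (σ-matches e) ⟩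
    lookup (membership D e) i              ≡⟨ lookup∘tabulate _ i ⟩
    lookup (D i) e                         ∎
    where open ≡-Reasoning

equal-ψ⇒image : ∀ {n k} (C D : Fin k → Subset n) → (∀ I → ψ C I ≡ ψ D I) →
                ∃ λ (π : Permutation′ n) → ∀ i → image π (C i) ≡ D i
equal-ψ⇒image {k = k} C D ψC≗ψD
  with σ , σ-matches ← equal-fibres⇒permutation (_==_ {k}) T-== (membership D) (membership C)
                         (λ I → trans (sym (ψ≡∣fibre∣ D I)) (trans (sym (ψC≗ψD I)) (ψ≡∣fibre∣ C I)))
  = flip σ , membership-matching⇒image C D σ σ-matches

image-ordering : ∀ {n k} {M N : Matroid n} {π} → IsIsomorphism M N π →
                 ∀ C → IsCHOrdering M k C → IsCHOrdering N k (image π ∘ C)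
image-ordering {π = π} iso C (injective , circuitHyperplane , complete) =
  (λ πCi≡πCj → injective (image-injective π πCi≡πCj)) ,
  image-circuitHyperplane iso ∘ circuitHyperplane ,
  λ X circuitHyperplaneX →
    let i , Ci≡ = complete (image (flip π) X) (image-circuitHyperplane (isIsomorphism-flip iso) circuitHyperplaneX)
    in i , trans (cong (image π) Ci≡) (image-image-flip π X)

isomorphic⇒common-ψ : ∀ {n k} {M N : Matroid n} → HasExactlyCH M k → Isomorphic M N →
                      ∃ λ (φ : Subset k → ℕ) → InR M k φ × InR N k φ
isomorphic⇒common-ψ {M = M} {N} (C , ordering) (π , iso) =
  ψ C , (C , ordering , λ _ → refl) ,
  (image π ∘ C , image-ordering (mkIsIsomorphism {M = M} {N} {π} iso) C ordering , λ I → sym (ψ-image π C I))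

T-injective : ∀ {a b} → (T a → T b) → (T b → T a) → a ≡ b
T-injective {true}  {true}  _ _ = refl
T-injective {true}  {false} a⇒b _ = ⊥-elim (a⇒b _)
T-injective {false} {true}  _ b⇒a = ⊥-elim (b⇒a _)
T-injective {false} {false} _ _ = refl

image-indep-sparsePaving : ∀ {n k} {M N : Matroid n} {C D} {π : Permutation′ n} → SparsePaving N →
  IsCHOrdering M (suc k) C → IsCHOrdering N (suc k) D → (∀ i → image π (C i) ≡ D i) →
  ∀ {X} → Indep M X → Indep N (image π X)
image-indep-sparsePaving {M = M} {N} {C} {D} {π} sparseN
  (_ , circuitHyperplaneC , _) (_ , circuitHyperplaneD , completeD) πC≡D {X} indX =
  sparsePaving-indep N sparseN (circuitHyperplaneD zero) ∣πX∣≤∣D₀∣ ¬circuitHyperplane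
  where
  ∣πX∣≤∣D₀∣ : ∣ image π X ∣ ≤ ∣ D zero ∣
  ∣πX∣≤∣D₀∣ with (dependentC₀ , _) , hyperplaneC₀ ← circuitHyperplaneC zero = begin
    ∣ image π X ∣        ≡⟨ ∣image∣ π X ⟩
    ∣ X ∣                ≤⟨ ∣indep∣≤∣dependentHyperplane∣ M hyperplaneC₀ dependentC₀ indX ⟩
    ∣ C zero ∣           ≡⟨ ∣image∣ π (C zero) ⟨
    ∣ image π (C zero) ∣ ≡⟨ cong ∣_∣ (πC≡D zero) ⟩
    ∣ D zero ∣           ∎
    where open ≤-Reasoning

  ¬circuitHyperplane : ¬ CircuitHyperplane N (image π X)
  ¬circuitHyperplane circuitHyperplaneπX with i , Di≡πX ← completeD _ circuitHyperplaneπX =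
    proj₁ (proj₁ (circuitHyperplaneC i)) (subst (Indep M) (sym (image-injective π (trans (πC≡D i) Di≡πX))) indX)

sparsePaving-isomorphism : ∀ {n k} {M N : Matroid n} {C D} {π : Permutation′ n} →
  SparsePaving M → SparsePaving N → IsCHOrdering M (suc k) C → IsCHOrdering N (suc k) D →
  (∀ i → image π (C i) ≡ D i) → IsIsomorphism M N π
sparsePaving-isomorphism {M = M} {N} {C} {D} {π} sparseM sparseN orderingC orderingD πC≡D = mkIsIsomorphism λ X →
  T-injective (image-indep-sparsePaving {M = M} {N} {π = π} sparseN orderingC orderingD πC≡D)
              (subst (Indep M) (image-flip-image π X) ∘ image-indep-sparsePaving {M = N} {M} {π = flip π} sparseM orderingD orderingC π⁻¹D≡C)
  where
  π⁻¹D≡C : ∀ i → image (flip π) (D i) ≡ C i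
  π⁻¹D≡C i = trans (cong (image (flip π)) (sym (πC≡D i))) (image-flip-image π (C i))

common-ψ⇒isomorphic : ∀ {n k} {M N : Matroid n} → SparsePaving M → SparsePaving N →
                      (∃ λ (φ : Subset (suc k) → ℕ) → InR M (suc k) φ × InR N (suc k) φ) → Isomorphic M N
common-ψ⇒isomorphic {M = M} {N} sparseM sparseN (φ , (C , orderingC , φ≗ψC) , (D , orderingD , φ≗ψD))
  with π , πC≡D ← equal-ψ⇒image C D (λ I → trans (sym (φ≗ψC I)) (φ≗ψD I))
  = π , indep-image (sparsePaving-isomorphism {M = M} {N} {C} {D} {π} sparseM sparseN orderingC orderingD πC≡D)

proposition2p2 : (k n : ℕ) → 0 < k → 0 < n → (M N : Matroid n) →
    SparsePaving M → SparsePaving N → HasExactlyCH M k → HasExactlyCH N k →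
    Isomorphic M N ⇔ (∃ λ (φ : Subset k → ℕ) → InR M k φ × InR N k φ)
proposition2p2 (suc k) n _ _ M N sparseM sparseN hasCH _ =
  mk⇔ (isomorphic⇒common-ψ {M = M} {N} hasCH) (common-ψ⇒isomorphic {M = M} {N} sparseM sparseN)
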